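{- Let $n\ge 3$ and $K\subseteq\{2,\ldots,n-1\}$. Then the generalised Fishburn domain $F_K$ is a directly connected domain of maximal width.
   Context: $[n]=\{1,\ldots,n\}$. The generalised Fishburn domain $F_K$ is the set of all linear orders $v$ on $[n]$ such that for all $1\le i<j<k\le n$: if $j\in K$ then $j$ is not ranked last by $v$ among $\{i,j,k\}$, and if $j\notin K$ then $j$ is not ranked first by $v$ among $\{i,j,k\}$. A domain of linear orders has maximal width if it contains two completely reversed orders (for $F_K$: $12\ldots n$ and $n\ldots 21$). The permutohedron of order $n$ is the graph whose vertices are the linear orders on $[n]$, two orders being adjacent if they differ by swapping two alternatives in neighbouring positions. A domain is directly connected if any two of its orders are joined by a shortest path (geodesic) in the permutohedron all of whose vertices belong to the domain. -}

module Defs where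

open import Data.Nat using (ℕ; zero; suc; _≤_; _<_; _∸_)
open import Data.List using (List; []; _∷_; _++_; applyUpTo; reverse)
open import Data.List.Membership.Propositional using (_∈_; _∉_)
open import Data.List.Relation.Binary.Permutation.Propositional using (_↭_)
open import Data.Product using (_×_; ∃; ∃-syntax; Σ-syntax)
open import Relation.Binary.PropositionalEquality using (_≡_)
open import Relation.Nullary using (¬_)

-- Alternatives are the naturals 1..n.  A linear order is a list of the
-- alternatives from best (head) to worst (last), i.e. a permutation of [1..n].
alternatives : ℕ → List ℕ
alternatives n = applyUpTo suc n

LinOrder : ℕ → List ℕ → Set
LinOrder n v = v ↭ alternatives n

Above : List ℕ → ℕ → ℕ → Set
Above v a b = ∃[ xs ] ∃[ ys ] ∃[ zs ] (v ≡ xs ++ a ∷ ys ++ b ∷ zs)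

Fishburn : ℕ → List ℕ → List ℕ → Set
Fishburn n K v =
  LinOrder n v ×
  (∀ i j k → 1 ≤ i → i < j → j < k → k ≤ n →
     (j ∈ K → ¬ (Above v i j × Above v k j)) ×
     (j ∉ K → ¬ (Above v j i × Above v j k)))

Adjacent : List ℕ → List ℕ → Set
Adjacent u w = ∃[ xs ] ∃[ a ] ∃[ b ] ∃[ ys ]
  (u ≡ xs ++ a ∷ b ∷ ys × w ≡ xs ++ b ∷ a ∷ ys)

data PathIn (P : List ℕ → Set) : List ℕ → List ℕ → ℕ → Set where
  here : ∀ {u} → P u → PathIn P u u 0
  step : ∀ {u v w m} → P u → Adjacent u v → PathIn P v w m → PathIn P u w (suc m)

DirectlyConnected : ℕ → (List ℕ → Set) → Set
DirectlyConnected n D =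
  ∀ u w → D u → D w →
    ∃[ m ] (PathIn D u w m × (∀ m' → PathIn (LinOrder n) u w m' → m ≤ m'))

MaximalWidth : (List ℕ → Set) → Set
MaximalWidth D = ∃[ v ] (D v × D (reverse v))

-- Distance in the permutohedron is the number of pairs that two orders rank differently:
-- an adjacent swap changes it by at most one, so a path inside F_K that removes one such
-- inversion per step is a geodesic.  Given u ≠ w in F_K, pick a pair with u ranking a
-- above b and w ranking b above a, where b < a (or, symmetrically, b > a).  If a and b are
-- not adjacent in u, or if swapping them leaves F_K, then the Fishburn conditions on u and w
-- produce another inverted pair that is smaller for a suitable well-founded weight; hence an
-- adjacent inverted pair whose swap stays in F_K is eventually found.  Maximal width is
-- witnessed by 12…n and its reverse.
module Submission where

open import Defs
open import Data.Nat using (ℕ; zero; suc; _+_; _∸_; _≤_; _<_; z≤n; s≤s; _≟_)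
open import Data.Nat.Properties
  using ( suc-injective; 0≢1+n; <⇒≢; <-asym; <-cmp; ≤-trans; ≤-<-trans; <-≤-trans; ≤-reflexive
        ; +-comm; +-assoc; +-identityʳ; m≤m+n; m<m+n; m∸n≤m; ∸-monoʳ-<
        ; +-monoʳ-≤; +-mono-<; +-monoˡ-<; +-monoʳ-<; m+n≡0⇒m≡0; m+n≡0⇒n≡0
        ; <-isStrictTotalOrder; module ≤-Reasoning)
open import Data.Nat.Induction using (<-wellFounded)
open import Data.Nat.Tactic.RingSolver using (solve-∀)
open import Data.List using (List; []; _∷_; _++_; [_]; _∷ʳ_; reverse)
open import Data.List.Properties using (++-assoc; reverse-++; unfold-reverse; reverse-involutive)
open import Data.List.Membership.Propositional using (_∈_; _∉_; lose)
open import Data.List.Membership.Propositional.Properties using (∈-∃++; ∈-++⁺ʳ; ∈-applyUpTo⁻)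
open import Data.List.Membership.DecPropositional _≟_ using (_∈?_)
open import Data.List.Relation.Unary.Any using (here; there; any?; satisfied)
open import Data.List.Relation.Unary.All as All using (All)
open import Data.List.Relation.Unary.AllPairs as AllPairs using (AllPairs; []; _∷_)
open import Data.List.Relation.Unary.AllPairs.Properties using (applyUpTo⁺₁)
open import Data.List.Relation.Unary.Unique.Propositional using (Unique)
open import Data.List.Relation.Binary.Subset.Propositional using (_⊆_)
open import Data.List.Relation.Binary.Permutation.Propositional
  using (_↭_; ↭-refl; ↭-sym; ↭-trans; swap; ↭⇒↭ₛ)
open import Data.List.Relation.Binary.Permutation.Propositional.Properties
  using (∈-resp-↭; ++⁺ˡ; ↭-reverse)
open import Data.Product using (_×_; _,_; proj₁; proj₂; ∃; ∃-syntax)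
open import Data.Sum using (_⊎_; inj₁; inj₂)
open import Data.Empty using (⊥; ⊥-elim)
open import Function using (id; flip)
open import Induction.WellFounded using (Acc; acc)
open import Relation.Binary.Definitions using (Asymmetric; tri<; tri≈; tri>)
open import Relation.Binary.Structures using (IsStrictTotalOrder)
import Relation.Binary.Construct.Flip.EqAndOrd as Flip
open import Relation.Binary.PropositionalEquality
  using (_≡_; _≢_; refl; sym; trans; cong; cong₂; subst; ≢-sym; module ≡-Reasoning; setoid)
open import Relation.Nullary using (¬_; Dec; yes; no)
open import Relation.Nullary.Decidable using (_×-dec_; _⊎-dec_; ¬?; map′; toSum)

open import Data.List.Relation.Binary.Permutation.Setoid.Properties (setoid ℕ)
  using (Unique-resp-↭)

-- A structurally recursive, decidable equivalent of Above.
Before : List ℕ → ℕ → ℕ → Set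
Before []      a b = ⊥
Before (x ∷ v) a b = (a ≡ x × b ∈ v) ⊎ Before v a b

before? : ∀ v a b → Dec (Before v a b)
before? []      a b = no λ ()
before? (x ∷ v) a b = (a ≟ x ×-dec b ∈? v) ⊎-dec before? v a b

Before⇒∈ˡ : ∀ {v a b} → Before v a b → a ∈ v
Before⇒∈ˡ {x ∷ v} (inj₁ (refl , _)) = here refl
Before⇒∈ˡ {x ∷ v} (inj₂ p)          = there (Before⇒∈ˡ p)

Before⇒∈ʳ : ∀ {v a b} → Before v a b → b ∈ v
Before⇒∈ʳ {x ∷ v} (inj₁ (_ , b∈v)) = there b∈v
Before⇒∈ʳ {x ∷ v} (inj₂ p)         = there (Before⇒∈ʳ p)

Before⇒≢ : ∀ {v a b} → Unique v → Before v a b → a ≢ b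
Before⇒≢ {x ∷ v} (x≢v ∷ _) (inj₁ (refl , b∈v)) = All.lookup x≢v b∈v
Before⇒≢ {x ∷ v} (_ ∷ v!)  (inj₂ p)            = Before⇒≢ v! p

Before-trans : ∀ {v a b c} → Unique v → Before v a b → Before v b c → Before v a c
Before-trans {x ∷ v} _         (inj₁ (a≡x , _)) (inj₁ (_ , c∈v)) = inj₁ (a≡x , c∈v)
Before-trans {x ∷ v} _         (inj₁ (a≡x , _)) (inj₂ q)         = inj₁ (a≡x , Before⇒∈ʳ q)
Before-trans {x ∷ v} (x≢v ∷ _) (inj₂ p) (inj₁ (refl , _)) =
  ⊥-elim (All.lookup x≢v (Before⇒∈ʳ p) refl)
Before-trans {x ∷ v} (_ ∷ v!)  (inj₂ p) (inj₂ q)          = inj₂ (Before-trans v! p q)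

Before-asym : ∀ {v a b} → Unique v → Before v a b → ¬ Before v b a
Before-asym v! p q = Before⇒≢ v! (Before-trans v! p q) refl

Before-connex : ∀ {v a b} → a ∈ v → b ∈ v → a ≢ b → Before v a b ⊎ Before v b a
Before-connex (here refl) (here refl) a≢b = ⊥-elim (a≢b refl)
Before-connex (here a≡x)  (there b∈v) _   = inj₁ (inj₁ (a≡x , b∈v))
Before-connex (there a∈v) (here b≡x)  _   = inj₂ (inj₁ (b≡x , a∈v))
Before-connex (there a∈v) (there b∈v) a≢b with Before-connex a∈v b∈v a≢b
... | inj₁ p = inj₁ (inj₂ p)
... | inj₂ p = inj₂ (inj₂ p)

Before-sorted : ∀ {R : ℕ → ℕ → Set} {v a b} → AllPairs R v → Before v a b → R a b
Before-sorted (a≺v ∷ _) (inj₁ (refl , b∈v)) = All.lookup a≺v b∈v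
Before-sorted (_ ∷ v≺)  (inj₂ p)            = Before-sorted v≺ p

Above⇒Before : ∀ {v a b} → Above v a b → Before v a b
Above⇒Before {a = a} {b} (xs , ys , zs , refl) = go xs
  where
  go : ∀ xs → Before (xs ++ a ∷ ys ++ b ∷ zs) a b
  go []       = inj₁ (refl , ∈-++⁺ʳ ys (here refl))
  go (x ∷ xs) = inj₂ (go xs)

Before⇒Above : ∀ {v a b} → Before v a b → Above v a b
Before⇒Above {x ∷ v} (inj₁ (refl , b∈v)) with ∈-∃++ b∈v
... | ys , zs , refl = [] , ys , zs , refl
Before⇒Above {x ∷ v} (inj₂ p) with Before⇒Above p
... | xs , ys , zs , refl = x ∷ xs , ys , zs , refl

Above-reverse : ∀ {v a b} → Above (reverse v) a b → Above v b a
Above-reverse {v} {a} {b} (xs , ys , zs , rv≡) = reverse zs , reverse ys , reverse xs , (begin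
  v                                                     ≡⟨ reverse-involutive v ⟨
  reverse (reverse v)                                   ≡⟨ cong reverse rv≡ ⟩
  reverse (xs ++ (a ∷ ys) ++ b ∷ zs)                    ≡⟨ reverse-++ xs _ ⟩
  reverse ((a ∷ ys) ++ b ∷ zs) ++ reverse xs            ≡⟨ cong (_++ reverse xs) (reverse-++ (a ∷ ys) (b ∷ zs)) ⟩
  (reverse (b ∷ zs) ++ reverse (a ∷ ys)) ++ reverse xs  ≡⟨ cong₂ (λ p q → (p ++ q) ++ reverse xs)
                                                                  (unfold-reverse b zs) (unfold-reverse a ys) ⟩
  ((reverse zs ∷ʳ b) ++ (reverse ys ∷ʳ a)) ++ reverse xs ≡⟨ ++-assoc (reverse zs ∷ʳ b) _ _ ⟩
  (reverse zs ∷ʳ b) ++ (reverse ys ∷ʳ a) ++ reverse xs  ≡⟨ ++-assoc (reverse zs) [ b ] _ ⟩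
  reverse zs ++ b ∷ (reverse ys ∷ʳ a) ++ reverse xs     ≡⟨ cong (λ t → reverse zs ++ b ∷ t)
                                                                  (++-assoc (reverse ys) [ a ] (reverse xs)) ⟩
  reverse zs ++ b ∷ reverse ys ++ a ∷ reverse xs        ∎)
  where open ≡-Reasoning

Before-reverse : ∀ {v a b} → Before (reverse v) a b → Before v b a
Before-reverse p = Above⇒Before (Above-reverse (Before⇒Above p))

Before-swap : ∀ xs {a b ys p q} → Before (xs ++ b ∷ a ∷ ys) p q →
              Before (xs ++ a ∷ b ∷ ys) p q ⊎ (p ≡ b × q ≡ a)
Before-swap []       (inj₁ (p≡b , here q≡a))   = inj₂ (p≡b , q≡a)
Before-swap []       (inj₁ (p≡b , there q∈ys)) = inj₁ (inj₂ (inj₁ (p≡b , q∈ys)))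
Before-swap []       (inj₂ (inj₁ (p≡a , q∈ys))) = inj₁ (inj₁ (p≡a , there q∈ys))
Before-swap []       (inj₂ (inj₂ r))           = inj₁ (inj₂ (inj₂ r))
Before-swap (x ∷ xs) (inj₁ (p≡x , q∈))         = inj₁ (inj₁ (p≡x , swapped xs q∈))
  where
  swapped : ∀ xs {a b ys q} → q ∈ xs ++ b ∷ a ∷ ys → q ∈ xs ++ a ∷ b ∷ ys
  swapped []       (here q≡b)         = there (here q≡b)
  swapped []       (there (here q≡a)) = here q≡a
  swapped []       (there (there q∈)) = there (there q∈)
  swapped (y ∷ xs) (here q≡y)         = here q≡y
  swapped (y ∷ xs) (there q∈)         = there (swapped xs q∈)
Before-swap (x ∷ xs) (inj₂ r) with Before-swap xs r
... | inj₁ r′ = inj₁ (inj₂ r′)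
... | inj₂ e  = inj₂ e

Before-adjacent⊎between : ∀ {v a b} → Before v a b →
  (∃[ xs ] ∃[ ys ] (v ≡ xs ++ a ∷ b ∷ ys)) ⊎ (∃[ c ] (Before v a c × Before v c b))
Before-adjacent⊎between {x ∷ y ∷ v} (inj₁ (refl , here refl)) = inj₁ ([] , v , refl)
Before-adjacent⊎between {x ∷ y ∷ v} (inj₁ (refl , there b∈v)) =
  inj₂ (y , inj₁ (refl , here refl) , inj₂ (inj₁ (refl , b∈v)))
Before-adjacent⊎between {x ∷ v} (inj₂ p) with Before-adjacent⊎between p
... | inj₁ (xs , ys , refl)  = inj₁ (x ∷ xs , ys , refl)
... | inj₂ (c , pac , pcb) = inj₂ (c , inj₂ pac , inj₂ pcb)

∃-within? : ∀ {P : ℕ → Set} v → (∀ {c} → P c → c ∈ v) → (∀ c → Dec (P c)) → Dec (∃ P)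
∃-within? v P⇒∈ P? = map′ satisfied (λ (c , pc) → lose (P⇒∈ pc) pc) (any? P? v)

indicator : ∀ {P : Set} → Dec P → ℕ
indicator (yes _) = 1
indicator (no _)  = 0

indicator≤1 : ∀ {P : Set} (d : Dec P) → indicator d ≤ 1
indicator≤1 (yes _) = s≤s z≤n
indicator≤1 (no _)  = z≤n

indicator-cong : ∀ {P Q : Set} → (P → Q) → (Q → P) → (d : Dec P) (e : Dec Q) →
                 indicator d ≡ indicator e
indicator-cong P⇒Q Q⇒P (yes _)  (yes _)  = refl
indicator-cong P⇒Q Q⇒P (yes p)  (no ¬q)  = ⊥-elim (¬q (P⇒Q p))
indicator-cong P⇒Q Q⇒P (no ¬p)  (yes q)  = ⊥-elim (¬p (Q⇒P q))
indicator-cong P⇒Q Q⇒P (no _)   (no _)   = refl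

countAbove : List ℕ → ℕ → List ℕ → ℕ
countAbove w x []      = 0
countAbove w x (y ∷ u) = indicator (before? w y x) + countAbove w x u

inversions : List ℕ → List ℕ → ℕ
inversions w []      = 0
inversions w (x ∷ u) = countAbove w x u + inversions w u

countAbove-swap : ∀ w x xs a b ys →
                  countAbove w x (xs ++ a ∷ b ∷ ys) ≡ countAbove w x (xs ++ b ∷ a ∷ ys)
countAbove-swap w x []       a b ys =
  middle-swap (indicator (before? w a x)) (indicator (before? w b x)) (countAbove w x ys)
  where
  middle-swap : ∀ p q r → p + (q + r) ≡ q + (p + r)
  middle-swap = solve-∀
countAbove-swap w x (y ∷ xs) a b ys = cong (indicator (before? w y x) +_) (countAbove-swap w x xs a b ys)

inversions-swap : ∀ w xs a b ys →
  inversions w (xs ++ a ∷ b ∷ ys) + indicator (before? w a b) ≡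
  inversions w (xs ++ b ∷ a ∷ ys) + indicator (before? w b a)
inversions-swap w [] a b ys =
  rearrange (indicator (before? w b a)) (indicator (before? w a b))
            (countAbove w a ys) (countAbove w b ys) (inversions w ys)
  where
  rearrange : ∀ p q r s t → ((p + r) + (s + t)) + q ≡ ((q + s) + (r + t)) + p
  rearrange = solve-∀
inversions-swap w (x ∷ xs) a b ys = begin
  (countAbove w x (xs ++ a ∷ b ∷ ys) + inversions w (xs ++ a ∷ b ∷ ys)) + indicator (before? w a b)
    ≡⟨ +-assoc (countAbove w x (xs ++ a ∷ b ∷ ys)) _ _ ⟩
  countAbove w x (xs ++ a ∷ b ∷ ys) + (inversions w (xs ++ a ∷ b ∷ ys) + indicator (before? w a b))
    ≡⟨ cong₂ _+_ (countAbove-swap w x xs a b ys) (inversions-swap w xs a b ys) ⟩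
  countAbove w x (xs ++ b ∷ a ∷ ys) + (inversions w (xs ++ b ∷ a ∷ ys) + indicator (before? w b a))
    ≡⟨ +-assoc (countAbove w x (xs ++ b ∷ a ∷ ys)) _ _ ⟨
  (countAbove w x (xs ++ b ∷ a ∷ ys) + inversions w (xs ++ b ∷ a ∷ ys)) + indicator (before? w b a) ∎
  where open ≡-Reasoning

inversions-swap-inverted : ∀ {w a b} xs ys → Unique w → Before w b a →
  inversions w (xs ++ a ∷ b ∷ ys) ≡ suc (inversions w (xs ++ b ∷ a ∷ ys))
inversions-swap-inverted {w} {a} {b} xs ys w! wba
  with before? w a b | before? w b a | inversions-swap w xs a b ys
... | yes wab | _       | _  = ⊥-elim (Before-asym w! wab wba)
... | no _    | no ¬wba | _  = ⊥-elim (¬wba wba)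
... | no _    | yes _   | eq = trans (sym (+-identityʳ _)) (trans eq (+-comm _ 1))

inversions-adjacent : ∀ w {u v} → Adjacent u v → inversions w u ≤ suc (inversions w v)
inversions-adjacent w (xs , a , b , ys , refl , refl) = begin
  inversions w (xs ++ a ∷ b ∷ ys)                                ≤⟨ m≤m+n _ _ ⟩
  inversions w (xs ++ a ∷ b ∷ ys) + indicator (before? w a b)    ≡⟨ inversions-swap w xs a b ys ⟩
  inversions w (xs ++ b ∷ a ∷ ys) + indicator (before? w b a)    ≤⟨ +-monoʳ-≤ _ (indicator≤1 (before? w b a)) ⟩
  inversions w (xs ++ b ∷ a ∷ ys) + 1                            ≡⟨ +-comm _ 1 ⟩
  suc (inversions w (xs ++ b ∷ a ∷ ys))                          ∎
  where open ≤-Reasoning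

countAbove-∉ : ∀ x w z u → x ∉ u → countAbove (x ∷ w) z u ≡ countAbove w z u
countAbove-∉ x w z []      _   = refl
countAbove-∉ x w z (y ∷ u) x∉u =
  cong₂ _+_ (indicator-cong drop inj₂ (before? (x ∷ w) y z) (before? w y z))
            (countAbove-∉ x w z u (λ x∈u → x∉u (there x∈u)))
  where
  drop : Before (x ∷ w) y z → Before w y z
  drop (inj₁ (refl , _)) = ⊥-elim (x∉u (here refl))
  drop (inj₂ p)          = p

inversions-∉ : ∀ x w u → x ∉ u → inversions (x ∷ w) u ≡ inversions w u
inversions-∉ x w []      _   = refl
inversions-∉ x w (y ∷ u) x∉u =
  cong₂ _+_ (countAbove-∉ x w y u (λ x∈u → x∉u (there x∈u)))
            (inversions-∉ x w u (λ x∈u → x∉u (there x∈u)))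

countAbove-top : ∀ w x u → (∀ y → ¬ Before w y x) → countAbove w x u ≡ 0
countAbove-top w x []      _   = refl
countAbove-top w x (y ∷ u) top with before? w y x
... | yes wyx = ⊥-elim (top y wyx)
... | no _    = countAbove-top w x u top

countAbove≡0 : ∀ w x u {y} → countAbove w x u ≡ 0 → y ∈ u → ¬ Before w y x
countAbove≡0 w x (y ∷ u) eq (here refl) wyx with before? w y x
... | no ¬wyx = ¬wyx wyx
countAbove≡0 w x (z ∷ u) eq (there y∈u) =
  countAbove≡0 w x u (m+n≡0⇒n≡0 (indicator (before? w z x)) eq) y∈u

countAbove≢0 : ∀ w x u → countAbove w x u ≢ 0 → ∃[ y ] (y ∈ u × Before w y x)
countAbove≢0 w x []      ne = ⊥-elim (ne refl)
countAbove≢0 w x (y ∷ u) ne with before? w y x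
... | yes wyx = y , here refl , wyx
... | no _ with countAbove≢0 w x u ne
...   | z , z∈u , wzx = z , there z∈u , wzx

inversions-self : ∀ {w} → Unique w → inversions w w ≡ 0
inversions-self {[]}    _            = refl
inversions-self {x ∷ w} (x≢w ∷ w!) =
  cong₂ _+_ (countAbove-top (x ∷ w) x w top) (trans (inversions-∉ x w w x∉w) (inversions-self w!))
  where
  x∉w : x ∉ w
  x∉w x∈w = All.lookup x≢w x∈w refl
  top : ∀ y → ¬ Before (x ∷ w) y x
  top y (inj₁ (_ , x∈w)) = x∉w x∈w
  top y (inj₂ p)         = x∉w (Before⇒∈ʳ p)

inversions≡0⇒≡ : ∀ {u w} → Unique u → Unique w → u ⊆ w → w ⊆ u → inversions w u ≡ 0 → u ≡ w
inversions≡0⇒≡ {[]}    {[]}    _ _ _   _   _ = refl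
inversions≡0⇒≡ {[]}    {y ∷ w} _ _ _   w⊆u _ with () ← w⊆u (here refl)
inversions≡0⇒≡ {x ∷ u} {[]}    _ _ u⊆w _   _ with () ← u⊆w (here refl)
inversions≡0⇒≡ {x ∷ u} {y ∷ w} (x≢u ∷ u!) (y≢w ∷ w!) u⊆w w⊆u eq with x ≟ y
... | yes refl = cong (x ∷_) (inversions≡0⇒≡ u! w! (tail⊆ x≢u u⊆w) (tail⊆ y≢w w⊆u) tail-eq)
  where
  tail⊆ : ∀ {z zs zs′} → All (z ≢_) zs → z ∷ zs ⊆ z ∷ zs′ → zs ⊆ zs′
  tail⊆ z≢zs ⊆′ t∈ with ⊆′ (there t∈)
  ... | here refl = ⊥-elim (All.lookup z≢zs t∈ refl)
  ... | there t∈′ = t∈′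
  tail-eq : inversions w u ≡ 0
  tail-eq = trans (sym (inversions-∉ x w u (λ x∈u → All.lookup x≢u x∈u refl)))
                  (m+n≡0⇒n≡0 (countAbove (x ∷ w) x u) eq)
... | no x≢y = ⊥-elim (countAbove≡0 (y ∷ w) x u (m+n≡0⇒m≡0 _ eq) y∈u (inj₁ (refl , x∈w)))
  where
  y∈u : y ∈ u
  y∈u with w⊆u (here refl)
  ... | here y≡x = ⊥-elim (x≢y (sym y≡x))
  ... | there y∈u = y∈u
  x∈w : x ∈ w
  x∈w with u⊆w (here refl)
  ... | here x≡y = ⊥-elim (x≢y x≡y)
  ... | there x∈w = x∈w

inversions≢0⇒inverted : ∀ w u → inversions w u ≢ 0 → ∃[ p ] ∃[ q ] (Before u p q × Before w q p)
inversions≢0⇒inverted w []      ne = ⊥-elim (ne refl)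
inversions≢0⇒inverted w (x ∷ u) ne with countAbove w x u ≟ 0
... | no ne′ with countAbove≢0 w x u ne′
...   | y , y∈u , wyx = x , y , inj₁ (refl , y∈u) , wyx
inversions≢0⇒inverted w (x ∷ u) ne | yes eq
  with inversions≢0⇒inverted w u (λ eq′ → ne (cong₂ _+_ eq eq′))
...   | p , q , upq , wqp = p , q , inj₂ upq , wqp

inversions-lowerBound : ∀ {P : List ℕ → Set} {u w m} → PathIn P u w m → Unique w → inversions w u ≤ m
inversions-lowerBound (here _)        w! = ≤-reflexive (inversions-self w!)
inversions-lowerBound {w = w} (step _ adj path) w! =
  ≤-trans (inversions-adjacent w adj) (s≤s (inversions-lowerBound path w!))

-- The Fishburn conditions relative to an arbitrary strict order _⊏_ on the alternatives;
-- they are unchanged when _⊏_ is reversed.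
NeverLast : (ℕ → ℕ → Set) → List ℕ → List ℕ → Set
NeverLast _⊏_ K v = ∀ {i j k} → i ⊏ j → j ⊏ k → j ∈ K → Before v i j → Before v k j → ⊥

NeverFirst : (ℕ → ℕ → Set) → List ℕ → List ℕ → Set
NeverFirst _⊏_ K v = ∀ {i j k} → i ⊏ j → j ⊏ k → j ∉ K → Before v j i → Before v j k → ⊥

module _ {_⊏_ : ℕ → ℕ → Set} {K v : List ℕ} where

  NeverLast-flip : NeverLast _⊏_ K v → NeverLast (flip _⊏_) K v
  NeverLast-flip never i⊐j j⊐k j∈K vij vkj = never j⊐k i⊐j j∈K vkj vij

  NeverFirst-flip : NeverFirst _⊏_ K v → NeverFirst (flip _⊏_) K v
  NeverFirst-flip never i⊐j j⊐k j∉K vji vjk = never j⊐k i⊐j j∉K vjk vji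

  ordered⇒NeverLast : Asymmetric _⊏_ → (∀ {a b} → Before v a b → a ⊏ b) → NeverLast _⊏_ K v
  ordered⇒NeverLast asym ordered _ j⊏k _ _ vkj = asym j⊏k (ordered vkj)

  ordered⇒NeverFirst : Asymmetric _⊏_ → (∀ {a b} → Before v a b → a ⊏ b) → NeverFirst _⊏_ K v
  ordered⇒NeverFirst asym ordered i⊏j _ _ vji _ = asym i⊏j (ordered vji)

ImprovingSwap : (ℕ → ℕ → Set) → List ℕ → List ℕ → List ℕ → Set
ImprovingSwap _⊏_ K u w =
  ∃[ v ] (Adjacent u v × v ↭ u × NeverLast _⊏_ K v × NeverFirst _⊏_ K v ×
          inversions w u ≡ suc (inversions w v))

ImprovingSwap-flip : ∀ {_⊏_ K u w} → ImprovingSwap (flip _⊏_) K u w → ImprovingSwap _⊏_ K u w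
ImprovingSwap-flip (v , adj , v↭u , last , first , eq) =
  v , adj , v↭u , NeverLast-flip last , NeverFirst-flip first , eq

module Descent (n : ℕ) (K : List ℕ) {_⊏_ : ℕ → ℕ → Set}
  (⊏-isStrictTotalOrder : IsStrictTotalOrder _≡_ _⊏_)
  (h : ℕ → ℕ)
  (h-mono : ∀ {x y} → x ≤ n → y ≤ n → x ⊏ y → h x < h y)
  (h≤n : ∀ {x} → x ≤ n → h x ≤ n)
  where

  open IsStrictTotalOrder ⊏-isStrictTotalOrder
    using (compare) renaming (_<?_ to _⊏?_; trans to ⊏-trans; asym to ⊏-asym)

  ⊏-connex : ∀ {x y} → x ≢ y → x ⊏ y ⊎ y ⊏ x
  ⊏-connex {x} {y} x≢y with compare x y
  ... | tri< x⊏y _ _ = inj₁ x⊏y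
  ... | tri≈ _ x≡y _ = ⊥-elim (x≢y x≡y)
  ... | tri> _ _ y⊏x = inj₂ y⊏x

  -- F ranks K ⊏-decreasingly below the other alternatives ⊏-increasingly, and G ranks the
  -- alternatives outside K ⊏-increasingly below K ⊏-decreasingly: each replacement of an
  -- inverted pair (b, a) made below lowers F b or G a and raises neither.
  F G : ℕ → ℕ
  F x with x ∈? K
  ... | yes _ = n ∸ h x
  ... | no _  = n + h x
  G x with x ∈? K
  ... | yes _ = suc (n + (n ∸ h x))
  ... | no _  = h x

  F-<-∉ : ∀ {x y} → x ≤ n → y ≤ n → x ⊏ y → y ∉ K → F x < F y
  F-<-∉ {x} {y} xn yn x⊏y y∉K with y ∈? K | x ∈? K
  ... | yes y∈K | _    = ⊥-elim (y∉K y∈K)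
  ... | no _    | yes _ = ≤-<-trans (m∸n≤m n (h x)) (m<m+n n (≤-<-trans z≤n (h-mono xn yn x⊏y)))
  ... | no _    | no _  = +-monoʳ-< n (h-mono xn yn x⊏y)

  F-<-∈ : ∀ {x y} → x ≤ n → y ≤ n → y ⊏ x → x ∈ K → F x < F y
  F-<-∈ {x} {y} xn yn y⊏x x∈K with x ∈? K | y ∈? K
  ... | no x∉K | _     = ⊥-elim (x∉K x∈K)
  ... | yes _  | yes _ = ∸-monoʳ-< (h-mono yn xn y⊏x) (h≤n xn)
  ... | yes _  | no _  =
    <-≤-trans (∸-monoʳ-< (≤-<-trans z≤n (h-mono yn xn y⊏x)) (h≤n xn)) (m≤m+n n (h y))

  G-<-∈ : ∀ {x y} → x ≤ n → y ≤ n → y ⊏ x → y ∈ K → G x < G y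
  G-<-∈ {x} {y} xn yn y⊏x y∈K with y ∈? K | x ∈? K
  ... | no y∉K | _     = ⊥-elim (y∉K y∈K)
  ... | yes _  | yes _ = s≤s (+-monoʳ-< n (∸-monoʳ-< (h-mono yn xn y⊏x) (h≤n xn)))
  ... | yes _  | no _  = s≤s (≤-trans (h≤n xn) (m≤m+n n _))

  G-<-∉ : ∀ {x y} → x ≤ n → y ≤ n → x ⊏ y → x ∉ K → G x < G y
  G-<-∉ {x} {y} xn yn x⊏y x∉K with x ∈? K | y ∈? K
  ... | yes x∈K | _     = ⊥-elim (x∉K x∈K)
  ... | no _    | no _  = h-mono xn yn x⊏y
  ... | no _    | yes _ = s≤s (≤-trans (h≤n xn) (m≤m+n n _))

  weight : ℕ → ℕ → ℕ
  weight b a = F b + G a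

  module _ {u w : List ℕ} (u! : Unique u) (w! : Unique w) (u⊆w : u ⊆ w)
           (u≤n : ∀ {x} → x ∈ u → x ≤ n)
           (u-last : NeverLast _⊏_ K u) (u-first : NeverFirst _⊏_ K u)
           (w-last : NeverLast _⊏_ K w) (w-first : NeverFirst _⊏_ K w)
    where

    Inversion : ℕ → ℕ → Set
    Inversion b a = b ⊏ a × Before u a b × Before w b a

    SmallerInversion : ℕ → ℕ → Set
    SmallerInversion b a = ∃[ b′ ] ∃[ a′ ] (weight b′ a′ < weight b a × Inversion b′ a′)

    w-connex : ∀ {x y} → x ∈ u → y ∈ u → x ≢ y → Before w x y ⊎ Before w y x
    w-connex x∈u y∈u = Before-connex (u⊆w x∈u) (u⊆w y∈u)

    shrink-between : ∀ {a b c} → Inversion b a → Before u a c → Before u c b → SmallerInversion b a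
    shrink-between {a} {b} {c} (b⊏a , uab , wba) uac ucb =
      by-position (⊏-connex (Before⇒≢ u! ucb)) (⊏-connex (≢-sym (Before⇒≢ u! uac)))
      where
      a∈u = Before⇒∈ˡ uab
      b∈u = Before⇒∈ʳ uab
      c∈u = Before⇒∈ʳ uac
      an = u≤n a∈u
      bn = u≤n b∈u
      cn = u≤n c∈u
      wca? : Before w c a ⊎ Before w a c
      wca? = w-connex c∈u a∈u (≢-sym (Before⇒≢ u! uac))
      wbc? : Before w b c ⊎ Before w c b
      wbc? = w-connex b∈u c∈u (≢-sym (Before⇒≢ u! ucb))

      by-position : c ⊏ b ⊎ b ⊏ c → c ⊏ a ⊎ a ⊏ c → SmallerInversion b a
      by-position (inj₁ c⊏b) _ with toSum (b ∈? K) | wca?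
      ... | inj₁ b∈K | _       = ⊥-elim (u-last c⊏b b⊏a b∈K ucb uab)
      ... | inj₂ b∉K | inj₁ wca =
        c , a , +-monoˡ-< (G a) (F-<-∉ cn bn c⊏b b∉K) , ⊏-trans c⊏b b⊏a , uac , wca
      ... | inj₂ b∉K | inj₂ wac = ⊥-elim (w-first c⊏b b⊏a b∉K (Before-trans w! wba wac) wba)
      by-position (inj₂ b⊏c) (inj₁ c⊏a) with toSum (c ∈? K)
      ... | inj₁ c∈K with wca?
      ...   | inj₁ wca = c , a , +-monoˡ-< (G a) (F-<-∈ cn bn b⊏c c∈K) , c⊏a , uac , wca
      ...   | inj₂ wac = ⊥-elim (w-last b⊏c c⊏a c∈K (Before-trans w! wba wac) wac)
      by-position (inj₂ b⊏c) (inj₁ c⊏a) | inj₂ c∉K with wbc?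
      ...   | inj₁ wbc = b , c , +-monoʳ-< (F b) (G-<-∉ cn an c⊏a c∉K) , b⊏c , ucb , wbc
      ...   | inj₂ wcb = ⊥-elim (w-first b⊏c c⊏a c∉K wcb (Before-trans w! wcb wba))
      by-position (inj₂ b⊏c) (inj₂ a⊏c) with toSum (a ∈? K)
      ... | inj₂ a∉K = ⊥-elim (u-first b⊏a a⊏c a∉K uab uac)
      ... | inj₁ a∈K with wbc?
      ...   | inj₁ wbc = b , c , +-monoʳ-< (F b) (G-<-∈ cn an a⊏c a∈K) , ⊏-trans b⊏a a⊏c , ucb , wbc
      ...   | inj₂ wcb = ⊥-elim (w-last b⊏a a⊏c a∈K wba (Before-trans w! wcb wba))

    BlocksLast : ℕ → Set
    BlocksLast a = a ∈ K × ∃[ c ] (a ⊏ c × Before u c a)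

    BlocksFirst : ℕ → Set
    BlocksFirst b = b ∉ K × ∃[ c ] (c ⊏ b × Before u b c)

    blocksLast? : ∀ a → Dec (BlocksLast a)
    blocksLast? a =
      a ∈? K ×-dec ∃-within? u (λ (_ , uca) → Before⇒∈ˡ uca) (λ c → a ⊏? c ×-dec before? u c a)

    blocksFirst? : ∀ b → Dec (BlocksFirst b)
    blocksFirst? b =
      ¬? (b ∈? K) ×-dec ∃-within? u (λ (_ , ubc) → Before⇒∈ʳ ubc) (λ c → c ⊏? b ×-dec before? u b c)

    swap-improves : ∀ {a b} xs ys → b ⊏ a → Before w b a → ¬ BlocksLast a → ¬ BlocksFirst b →
                    u ≡ xs ++ a ∷ b ∷ ys → ImprovingSwap _⊏_ K u w
    swap-improves {a} {b} xs ys b⊏a wba ¬last ¬first refl =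
      xs ++ b ∷ a ∷ ys , (xs , a , b , ys , refl , refl) , ++⁺ˡ xs (swap b a ↭-refl) ,
      v-last , v-first , inversions-swap-inverted xs ys w! wba
      where
      v-last : NeverLast _⊏_ K (xs ++ b ∷ a ∷ ys)
      v-last i⊏j j⊏k j∈K vij vkj with Before-swap xs vij | Before-swap xs vkj
      ... | inj₁ uij           | inj₁ ukj           = u-last i⊏j j⊏k j∈K uij ukj
      ... | inj₁ _             | inj₂ (refl , refl) = ⊏-asym j⊏k b⊏a
      ... | inj₂ (refl , refl) | inj₁ ukj           = ¬last (j∈K , _ , j⊏k , ukj)
      ... | inj₂ (refl , refl) | inj₂ (refl , refl) = ⊏-asym i⊏j j⊏k
      v-first : NeverFirst _⊏_ K (xs ++ b ∷ a ∷ ys)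
      v-first i⊏j j⊏k j∉K vji vjk with Before-swap xs vji | Before-swap xs vjk
      ... | inj₁ uji           | inj₁ ujk           = u-first i⊏j j⊏k j∉K uji ujk
      ... | inj₁ uji           | inj₂ (refl , refl) = ¬first (j∉K , _ , i⊏j , uji)
      ... | inj₂ (refl , refl) | _                  = ⊏-asym i⊏j b⊏a

    shrink-adjacent : ∀ {a b} xs ys → Inversion b a → u ≡ xs ++ a ∷ b ∷ ys →
                      ImprovingSwap _⊏_ K u w ⊎ SmallerInversion b a
    shrink-adjacent {a} {b} xs ys (b⊏a , uab , wba) u≡ with blocksLast? a | blocksFirst? b
    ... | yes (a∈K , c , a⊏c , uca) | _ =
      inj₂ (a , c , +-mono-< (F-<-∈ an bn b⊏a a∈K) (G-<-∈ cn an a⊏c a∈K) , a⊏c , uca , wac)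
      where
      an = u≤n (Before⇒∈ˡ uab)
      bn = u≤n (Before⇒∈ʳ uab)
      cn = u≤n (Before⇒∈ˡ uca)
      wac : Before w a c
      wac with w-connex (Before⇒∈ʳ uca) (Before⇒∈ˡ uca) (≢-sym (Before⇒≢ u! uca))
      ... | inj₁ wac = wac
      ... | inj₂ wca = ⊥-elim (w-last b⊏a a⊏c a∈K wba wca)
    ... | no _ | yes (b∉K , c , c⊏b , ubc) =
      inj₂ (c , b , +-mono-< (F-<-∉ cn bn c⊏b b∉K) (G-<-∉ bn an b⊏a b∉K) , c⊏b , ubc , wcb)
      where
      an = u≤n (Before⇒∈ˡ uab)
      bn = u≤n (Before⇒∈ʳ uab)
      cn = u≤n (Before⇒∈ʳ ubc)
      wcb : Before w c b
      wcb with w-connex (Before⇒∈ˡ ubc) (Before⇒∈ʳ ubc) (Before⇒≢ u! ubc)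
      ... | inj₁ wbc = ⊥-elim (w-first c⊏b b⊏a b∉K wbc wba)
      ... | inj₂ wcb = wcb
    ... | no ¬last | no ¬first = inj₁ (swap-improves xs ys b⊏a wba ¬last ¬first u≡)

    shrink : ∀ {a b} → Inversion b a → ImprovingSwap _⊏_ K u w ⊎ SmallerInversion b a
    shrink inv@(_ , uab , _) with Before-adjacent⊎between uab
    ... | inj₁ (xs , ys , u≡)  = shrink-adjacent xs ys inv u≡
    ... | inj₂ (c , uac , ucb) = inj₂ (shrink-between inv uac ucb)

    improvingSwap-acc : ∀ {a b} → Acc _<_ (weight b a) → Inversion b a → ImprovingSwap _⊏_ K u w
    improvingSwap-acc (acc smaller) inv with shrink inv
    ... | inj₁ improving              = improving
    ... | inj₂ (_ , _ , lighter , inv′) = improvingSwap-acc (smaller lighter) inv′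

    improvingSwap : ∀ {a b} → Inversion b a → ImprovingSwap _⊏_ K u w
    improvingSwap = improvingSwap-acc (<-wellFounded _)

module Ascending (n : ℕ) (K : List ℕ) =
  Descent n K <-isStrictTotalOrder id (λ _ _ x<y → x<y) id

module Descending (n : ℕ) (K : List ℕ) =
  Descent n K (Flip.isStrictTotalOrder <-isStrictTotalOrder) (n ∸_)
          (λ x≤n _ y<x → ∸-monoʳ-< y<x x≤n) (λ {x} _ → m∸n≤m n x)

∈-alternatives⁻ : ∀ {n x} → x ∈ alternatives n → 1 ≤ x × x ≤ n
∈-alternatives⁻ x∈ with ∈-applyUpTo⁻ suc x∈
... | i , i<n , refl = s≤s z≤n , i<n

alternatives-sorted : ∀ n → AllPairs _<_ (alternatives n)
alternatives-sorted n = applyUpTo⁺₁ suc n (λ i<j _ → s≤s i<j)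

LinOrder⇒Unique : ∀ {n v} → LinOrder n v → Unique v
LinOrder⇒Unique {n} v↭ =
  Unique-resp-↭ (↭⇒↭ₛ (↭-sym v↭)) (AllPairs.map <⇒≢ (alternatives-sorted n))

LinOrder⇒⊆ : ∀ {n u w} → LinOrder n u → LinOrder n w → u ⊆ w
LinOrder⇒⊆ u↭ w↭ = ∈-resp-↭ (↭-trans u↭ (↭-sym w↭))

module _ {n : ℕ} {K : List ℕ} where

  Fishburn⇒≤n : ∀ {v x} → Fishburn n K v → x ∈ v → x ≤ n
  Fishburn⇒≤n (v↭ , _) x∈v = proj₂ (∈-alternatives⁻ (∈-resp-↭ v↭ x∈v))

  Fishburn⇒NeverLast : ∀ {v} → Fishburn n K v → NeverLast _<_ K v
  Fishburn⇒NeverLast (v↭ , conditions) {i} {j} {k} i<j j<k j∈K vij vkj =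
    proj₁ (conditions i j k 1≤i i<j j<k k≤n) j∈K (Before⇒Above vij , Before⇒Above vkj)
    where
    1≤i = proj₁ (∈-alternatives⁻ (∈-resp-↭ v↭ (Before⇒∈ˡ vij)))
    k≤n = proj₂ (∈-alternatives⁻ (∈-resp-↭ v↭ (Before⇒∈ˡ vkj)))

  Fishburn⇒NeverFirst : ∀ {v} → Fishburn n K v → NeverFirst _<_ K v
  Fishburn⇒NeverFirst (v↭ , conditions) {i} {j} {k} i<j j<k j∉K vji vjk =
    proj₂ (conditions i j k 1≤i i<j j<k k≤n) j∉K (Before⇒Above vji , Before⇒Above vjk)
    where
    1≤i = proj₁ (∈-alternatives⁻ (∈-resp-↭ v↭ (Before⇒∈ʳ vji)))
    k≤n = proj₂ (∈-alternatives⁻ (∈-resp-↭ v↭ (Before⇒∈ʳ vjk)))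

  Fishburn-intro : ∀ {v} → LinOrder n v → NeverLast _<_ K v → NeverFirst _<_ K v → Fishburn n K v
  Fishburn-intro v↭ last first = v↭ , λ i j k _ i<j j<k _ →
    (λ j∈K (vij , vkj) → last i<j j<k j∈K (Above⇒Before vij) (Above⇒Before vkj)) ,
    (λ j∉K (vji , vjk) → first i<j j<k j∉K (Above⇒Before vji) (Above⇒Before vjk))

  module _ {u w : List ℕ} (fu : Fishburn n K u) (fw : Fishburn n K w) where

    private
      u! : Unique u
      u! = LinOrder⇒Unique (proj₁ fu)
      w! : Unique w
      w! = LinOrder⇒Unique (proj₁ fw)
      u⊆w : u ⊆ w
      u⊆w = LinOrder⇒⊆ (proj₁ fu) (proj₁ fw)
      u-last : NeverLast _<_ K u
      u-last = Fishburn⇒NeverLast fu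
      u-first : NeverFirst _<_ K u
      u-first = Fishburn⇒NeverFirst fu
      w-last : NeverLast _<_ K w
      w-last = Fishburn⇒NeverLast fw
      w-first : NeverFirst _<_ K w
      w-first = Fishburn⇒NeverFirst fw

    fishburn-swap : ∀ {k} → inversions w u ≡ suc k → ImprovingSwap _<_ K u w →
                    ∃[ v ] (Adjacent u v × Fishburn n K v × inversions w v ≡ k)
    fishburn-swap eq (v , adj , v↭u , last , first , eq′) =
      v , adj , Fishburn-intro (↭-trans v↭u (proj₁ fu)) last first , suc-injective (trans (sym eq′) eq)

    fishburn-step : ∀ {k} → inversions w u ≡ suc k →
                    ∃[ v ] (Adjacent u v × Fishburn n K v × inversions w v ≡ k)
    fishburn-step eq with inversions≢0⇒inverted w u (λ eq′ → 0≢1+n (trans (sym eq′) eq))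
    ... | p , q , upq , wqp with <-cmp q p
    ... | tri< q<p _ _ = fishburn-swap eq (Ascending.improvingSwap n K u! w! u⊆w (Fishburn⇒≤n fu)
            u-last u-first w-last w-first (q<p , upq , wqp))
    ... | tri≈ _ q≡p _ = ⊥-elim (Before⇒≢ u! upq (sym q≡p))
    ... | tri> _ _ p<q = fishburn-swap eq (ImprovingSwap-flip
            (Descending.improvingSwap n K u! w! u⊆w (Fishburn⇒≤n fu)
              (NeverLast-flip u-last) (NeverFirst-flip u-first) (NeverLast-flip w-last) (NeverFirst-flip w-first)
              (p<q , upq , wqp)))

  geodesic : ∀ {u w} k → Fishburn n K u → Fishburn n K w → inversions w u ≡ k →
             PathIn (Fishburn n K) u w k
  geodesic {u} zero fu fw eq =
    subst (λ t → PathIn (Fishburn n K) u t 0)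
          (inversions≡0⇒≡ (LinOrder⇒Unique (proj₁ fu)) (LinOrder⇒Unique (proj₁ fw))
                          (LinOrder⇒⊆ (proj₁ fu) (proj₁ fw)) (LinOrder⇒⊆ (proj₁ fw) (proj₁ fu)) eq)
          (here fu)
  geodesic (suc k) fu fw eq with fishburn-step fu fw eq
  ... | v , adj , fv , eq′ = step fu adj (geodesic k fv fw eq′)

  directlyConnected : DirectlyConnected n (Fishburn n K)
  directlyConnected u w fu fw =
    inversions w u , geodesic _ fu fw refl , λ _ path → inversions-lowerBound path (LinOrder⇒Unique (proj₁ fw))

  maximalWidth : MaximalWidth (Fishburn n K)
  maximalWidth =
    alternatives n ,
    Fishburn-intro ↭-refl (ordered⇒NeverLast <-asym increasing) (ordered⇒NeverFirst <-asym increasing) ,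
    Fishburn-intro (↭-reverse (alternatives n))
      (NeverLast-flip (ordered⇒NeverLast <-asym decreasing))
      (NeverFirst-flip (ordered⇒NeverFirst <-asym decreasing))
    where
    increasing : ∀ {a b} → Before (alternatives n) a b → a < b
    increasing = Before-sorted (alternatives-sorted n)
    decreasing : ∀ {a b} → Before (reverse (alternatives n)) a b → b < a
    decreasing p = increasing (Before-reverse p)

theorem3 : (n : ℕ) → 3 ≤ n → (K : List ℕ) →
    All (λ j → 2 ≤ j × j ≤ n ∸ 1) K →
    DirectlyConnected n (Fishburn n K) × MaximalWidth (Fishburn n K)
theorem3 n _ K _ = directlyConnected , maximalWidth
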